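{- Let $p$ be a prime, let $a,b,z\in\mathbb Z$ with $z \ge 0$ and $p\nmid a$ and $a^z\equiv b\pmod p$, and let $k\in\mathbb N$. Then the algorithm DLL described below, run on input $(a,z,b,p,k)$, terminates and either outputs an integer $x\geq 0$ such that $a^x\equiv b\pmod{p^k}$, or outputs None; and it outputs None only if no integer $x\geq 0$ with $a^x\equiv b\pmod{p^k}$ exists.
   Context: Notation: for integers $u$ and $w>0$, $u \bmod w$ denotes the least non-negative residue of $u$ modulo $w$, and $\lfloor u/w\rfloor$ denotes floor division. $\nu_p$ denotes the $p$-adic valuation. Convention $0^0=1$. Algorithm DLL, on input integers $(a,z,b,p,k)$ with $p$ prime, $k\ge 0$, $z\ge 0$, executes the following steps with integer variables: 1. $m \leftarrow p^k$; $z\leftarrow z \bmod (p-1)$; $a\leftarrow a\bmod m$; $b\leftarrow b\bmod m$; $c\leftarrow a^z \bmod m$; $y\leftarrow 0$. 2. If $p=2$: $u\leftarrow 2$ and $e\leftarrow a^2\bmod m$. Otherwise: $u\leftarrow 1$ and $e\leftarrow a^{p-1}\bmod m$. 3. $h\leftarrow e-1$; $r\leftarrow 0$; while $p\mid h$ and $r<k$: $h\leftarrow h/p$, $r\leftarrow r+1$. (So $r=\min\{\nu_p(e-1),k\}$ and $h=(e-1)/p^r$.) Then $v\leftarrow p^r$. 4. If $v\nmid (b-c)$: if $p>2$ or $v\nmid (b-a)$, output None and stop; otherwise set $c\leftarrow a$ and $y\leftarrow 1$. 5. $g\leftarrow (hb)^{p-2}\bmod p$. 6. While $b\neq c$, repeat: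 (a) $d\leftarrow \big(g\cdot\lfloor (b-c)/v\rfloor\big)\bmod p$; $y\leftarrow y+d\,u$. (b) If $2r\ge k$: $f\leftarrow (1+(e-1)d)\bmod m$ and $e\leftarrow (1+(e-1)p)\bmod m$. Otherwise: $f\leftarrow e^d\bmod m$ and $e\leftarrow (f\cdot e^{p-d})\bmod m$. (c) $c\leftarrow (c f)\bmod m$; $u\leftarrow up$; $v\leftarrow vp$; $r\leftarrow r+1$. 7. Output $x=(p-1)y+z$. -}

module Defs where

open import Data.Nat as ℕ using (ℕ; zero; suc)
open import Data.Integer as ℤ using (ℤ; +_; _+_; _-_; _*_; _^_; _/ℕ_; _%ℕ_)
open import Data.Bool using (Bool; true; false; if_then_else_)
open import Data.Maybe using (Maybe; just; nothing)
open import Data.Product using (_×_; _,_)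
open import Relation.Nullary.Decidable using (⌊_⌋)

-- Least non-negative residue  u mod w  (w > 0), as an integer.
-- (For w = 0 the value is irrelevant: the algorithm only ever reduces
--  modulo p, p^k, which are positive when p is prime.)
modZ : ℤ → ℕ → ℤ
modZ u zero    = u
modZ u (suc w) = + (u %ℕ suc w)

-- Floor division  ⌊u / w⌋  (w > 0).  (w = 0 never occurs, see above.)
divZ : ℤ → ℕ → ℤ
divZ u zero    = ℤ.0ℤ
divZ u (suc w) = u /ℕ suc w

dividesB : ℕ → ℤ → Bool
dividesB zero    u = ⌊ u ℤ.≟ ℤ.0ℤ ⌋
dividesB (suc w) u = ⌊ (u %ℕ suc w) ℕ.≟ 0 ⌋

-- Step 3:  while p ∣ h and r < k : h ← h/p ; r ← r+1.
-- The first argument is the remaining budget k - r.  Returns (h , r).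
strip : ℕ → ℕ → ℤ → ℤ × ℕ
strip p zero    h = h , 0
strip p (suc j) h with dividesB p h
... | false = h , 0
... | true  with strip p j (divZ h p)
...   | h' , r' = h' , suc r'

record LoopState : Set where
  constructor st
  field
    y : ℤ
    u : ℕ
    v : ℕ
    r : ℕ
    e : ℤ
    c : ℤ

loopBody : (p k m : ℕ) (b g : ℤ) → LoopState → LoopState
loopBody p k m b g (st y u v r e c) =
  let d  = modZ (g * divZ (b - c) v) p
      y' = y + d * + u
      fe = if ⌊ k ℕ.≤? 2 ℕ.* r ⌋
             then (modZ (ℤ.1ℤ + (e - ℤ.1ℤ) * d) m , modZ (ℤ.1ℤ + (e - ℤ.1ℤ) * + p) m)
             else (let f = modZ (e ^ ℤ.∣ d ∣) m
                   in f , modZ (f * e ^ (p ℕ.∸ ℤ.∣ d ∣)) m)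
  in st y' (u ℕ.* p) (v ℕ.* p) (suc r) (Data.Product.proj₂ fe)
        (modZ (c * Data.Product.proj₁ fe) m)

-- Step 6 with a fuel bound: `nothing` means the fuel ran out before
-- the loop condition  b ≠ c  became false.
loop : ℕ → (p k m : ℕ) (b g : ℤ) → LoopState → Maybe LoopState
loop zero    p k m b g s = nothing
loop (suc n) p k m b g s with ⌊ b ℤ.≟ LoopState.c s ⌋
... | true  = just s
... | false = loop n p k m b g (loopBody p k m b g s)

-- z mod (p-1)  (p ≥ 2 for p prime; the p-1 = 0 branch is irrelevant)
zmod : ℕ → ℕ → ℕ
zmod z p with p ℕ.∸ 1
... | zero  = z
... | suc q = z ℕ.% suc q

-- Algorithm DLL run with fuel n (bound on the number of iterations of
-- the step-6 loop) on input (a, z, b, p, k):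
--   nothing        : did not halt within the given fuel
--   just nothing   : halted with output None
--   just (just x)  : halted with output the integer x
DLL : (fuel : ℕ) (a : ℤ) (z : ℕ) (b : ℤ) (p k : ℕ) → Maybe (Maybe ℤ)
DLL fuel a₀ z₀ b₀ p k = step4 (dividesB v (b - c)) (dividesB v (b - a))
  where
    m = p ℕ.^ k
    z = zmod z₀ p
    a = modZ a₀ m
    b = modZ b₀ m
    c = modZ (a ^ z) m
    isTwo = ⌊ p ℕ.≟ 2 ⌋
    u = if isTwo then 2 else 1
    e = if isTwo then modZ (a ^ 2) m else modZ (a ^ (p ℕ.∸ 1)) m
    h = Data.Product.proj₁ (strip p k (e - ℤ.1ℤ))
    r = Data.Product.proj₂ (strip p k (e - ℤ.1ℤ))
    v = p ℕ.^ r
    g = modZ ((h * b) ^ (p ℕ.∸ 2)) p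
    run : LoopState → Maybe (Maybe ℤ)
    run s0 with loop fuel p k m b g s0
    ... | nothing = nothing
    ... | just s  = just (just (+ (p ℕ.∸ 1) * LoopState.y s + + z))
    step4 : Bool → Bool → Maybe (Maybe ℤ)
    step4 true  _     = run (st ℤ.0ℤ u v r e c)
    step4 false false = just nothing
    step4 false true  = if ⌊ 3 ℕ.≤? p ⌋ then just nothing else run (st ℤ.1ℤ u v r e a)

-- Powers e of a lying in 1 + pℤ (e = a^(p-1), or a² when
-- p = 2) behave like a p-adic exponential: if e ≡ 1 + h·pʳ (mod pʳ⁺¹) with p ∤ h and r ≥ 1 (r ≥ 2
-- when p = 2), then e^p ≡ 1 + h·pʳ⁺¹ (mod pʳ⁺²), by the binomial theorem and p ∣ C(p,2) for odd p.
-- So once b ≡ c (mod pʳ), the digit d ≡ (h·b)⁻¹·(b - c)/pʳ (mod p), with the inverse computed by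
-- Fermat's little theorem, gives b ≡ c·eᵈ (mod pʳ⁺¹); r grows by one per round until it reaches k,
-- when b and c are equal residues. Conversely a solution n forces aⁿ ≡ a^z (mod p); as a^(p-1) ≡ 1
-- (mod pʳ) and p ∤ p - 1, this lifts to pʳ, so the first test of DLL fails only if there is no
-- solution (for p = 2, b ≡ a^(n mod 2) (mod 2ʳ), which one of the two tests detects).

module Submission where

open import Data.Bool.Base using (true; false; if_then_else_)
open import Data.Empty using (⊥)
open import Data.Integer.Base as ℤ using (ℤ; +_; _+_; _-_; _*_; _^_; -_; ∣_∣; 0ℤ; 1ℤ; _%ℕ_; _/ℕ_; _≤_)
import Data.Integer.Divisibility as Unsigned
open import Data.Integer.Divisibility.Signed
import Data.Integer.DivMod as ℤ
import Data.Integer.Properties as ℤ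
open import Data.Integer.Tactic.RingSolver using (solve-∀)
open import Data.Maybe.Base using (Maybe; just; nothing)
open import Data.Nat.Base as ℕ using (ℕ; zero; suc; NonZero; _!)
open import Data.Nat.Combinatorics using (_C_; nC1≡n; nCn≡1; nCk≡n!/k![n-k]!; k>n⇒nCk≡0; k![n∸k]!∣n!; nCk+nC[k+1]≡[n+1]C[k+1])
import Data.Nat.Divisibility as ℕ
import Data.Nat.DivMod as ℕ
open import Data.Nat.Primality using (Prime; euclidsLemma; prime⇒nonZero; prime⇒nonTrivial; ¬prime[0]; ¬prime[1])
import Data.Nat.Properties as ℕ
import Data.Nat.Tactic.RingSolver as ℕ-Solver
open import Data.Product.Base using (Σ; _×_; _,_; proj₁; proj₂)
open import Data.Sum.Base using (_⊎_; inj₁; inj₂; [_,_]′)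
open import Function.Base using (_∘_; flip)
open import Level using (0ℓ)
open import Relation.Binary.Bundles using (Setoid)
open import Relation.Binary.PropositionalEquality
open import Relation.Nullary.Decidable using (isYes≗does)
open import Relation.Nullary.Decidable.Core using (yes; no; ⌊_⌋; proof; map′)
open import Relation.Nullary.Negation using (¬_; contradiction)
open import Relation.Nullary.Reflects using (Reflects; ofʸ; ofⁿ)
open import Defs

-- Congruences modulo an integer

infix 4 _≡_mod_
record _≡_mod_ (x y m : ℤ) : Set where
  constructor mod∣
  field ∣-diff : m ∣ x - y
open _≡_mod_ public

module _ {m : ℤ} where

  ≡mod-refl : ∀ {x} → x ≡ x mod m
  ≡mod-refl {x} = mod∣ (divides 0ℤ (x-x≡0*m x m))
    where x-x≡0*m : ∀ x m → x - x ≡ 0ℤ * m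
          x-x≡0*m = solve-∀

  ≡⇒≡mod : ∀ {x y} → x ≡ y → x ≡ y mod m
  ≡⇒≡mod refl = ≡mod-refl

  ≡mod-sym : ∀ {x y} → x ≡ y mod m → y ≡ x mod m
  ≡mod-sym {x} {y} (mod∣ d) = mod∣ (subst (m ∣_) (-[x-y]≡y-x x y) (∣m⇒∣-m d))
    where -[x-y]≡y-x : ∀ x y → - (x - y) ≡ y - x
          -[x-y]≡y-x = solve-∀

  ≡mod-trans : ∀ {x y w} → x ≡ y mod m → y ≡ w mod m → x ≡ w mod m
  ≡mod-trans {x} {y} {w} (mod∣ d) (mod∣ d′) = mod∣ (subst (m ∣_) (telescope x y w) (∣m∣n⇒∣m+n d d′))
    where telescope : ∀ x y w → (x - y) + (y - w) ≡ x - w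
          telescope = solve-∀

  +-≡mod : ∀ {x y u w} → x ≡ y mod m → u ≡ w mod m → x + u ≡ y + w mod m
  +-≡mod {x} {y} {u} {w} (mod∣ d) (mod∣ d′) = mod∣ (subst (m ∣_) (regroup x y u w) (∣m∣n⇒∣m+n d d′))
    where regroup : ∀ x y u w → (x - y) + (u - w) ≡ (x + u) - (y + w)
          regroup = solve-∀

  -‿≡mod : ∀ {x y u w} → x ≡ y mod m → u ≡ w mod m → x - u ≡ y - w mod m
  -‿≡mod {x} {y} {u} {w} (mod∣ d) (mod∣ d′) = mod∣ (subst (m ∣_) (regroup x y u w) (∣m∣n⇒∣m-n d d′))
    where regroup : ∀ x y u w → (x - y) - (u - w) ≡ (x - u) - (y - w)
          regroup = solve-∀

  *-≡mod : ∀ {x y u w} → x ≡ y mod m → u ≡ w mod m → x * u ≡ y * w mod m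
  *-≡mod {x} {y} {u} {w} (mod∣ d) (mod∣ d′) =
    mod∣ (subst (m ∣_) (regroup x y u w) (∣m∣n⇒∣m+n (∣n⇒∣m*n x d′) (∣m⇒∣m*n w d)))
    where regroup : ∀ x y u w → x * (u - w) + (x - y) * w ≡ x * u - y * w
          regroup = solve-∀

  +-≡modˡ : ∀ x {u w} → u ≡ w mod m → x + u ≡ x + w mod m
  +-≡modˡ x = +-≡mod {x = x} ≡mod-refl

  -‿≡modˡ : ∀ x {u w} → u ≡ w mod m → x - u ≡ x - w mod m
  -‿≡modˡ x = -‿≡mod {x = x} ≡mod-refl

  *-≡modˡ : ∀ x {u w} → u ≡ w mod m → x * u ≡ x * w mod m
  *-≡modˡ x = *-≡mod {x = x} ≡mod-refl

  *-≡modʳ : ∀ {x y} u → x ≡ y mod m → x * u ≡ y * u mod m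
  *-≡modʳ u x≡y = *-≡mod {u = u} x≡y ≡mod-refl

  ^-≡mod : ∀ {x y} n → x ≡ y mod m → x ^ n ≡ y ^ n mod m
  ^-≡mod zero    _   = ≡mod-refl
  ^-≡mod (suc n) x≡y = *-≡mod x≡y (^-≡mod n x≡y)

  ∣⇒≡mod0 : ∀ {x} → m ∣ x → x ≡ 0ℤ mod m
  ∣⇒≡mod0 {x} = mod∣ ∘ subst (m ∣_) (sym (ℤ.+-identityʳ x))

  ≡mod0⇒∣ : ∀ {x} → x ≡ 0ℤ mod m → m ∣ x
  ≡mod0⇒∣ {x} (mod∣ d) = subst (m ∣_) (ℤ.+-identityʳ x) d

≡mod-weaken : ∀ {m n x y} → n ∣ m → x ≡ y mod m → x ≡ y mod n
≡mod-weaken n∣m (mod∣ d) = mod∣ (∣-trans n∣m d)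

≡1+x⇒-1≡ : ∀ {e x m} (e≡1+x : e ≡ 1ℤ + x mod m) → e - 1ℤ ≡ x + quotient (∣-diff e≡1+x) * m
≡1+x⇒-1≡ {e} {x} {m} (mod∣ (divides w e-[1+x]≡wm)) =
  trans (regroup e x) (trans (cong (_+ x) e-[1+x]≡wm) (ℤ.+-comm (w * m) x))
  where regroup : ∀ e x → e - 1ℤ ≡ e - (1ℤ + x) + x
        regroup = solve-∀

≡mod-setoid : ℤ → Setoid 0ℓ 0ℓ
≡mod-setoid m = record
  { Carrier = ℤ
  ; _≈_ = λ x y → x ≡ y mod m
  ; isEquivalence = record { refl = ≡mod-refl ; sym = ≡mod-sym ; trans = ≡mod-trans }
  }

module ≡mod-Reasoning (m : ℤ) where
  open import Relation.Binary.Reasoning.Setoid (≡mod-setoid m) public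

-- Powers, binomial sums and Fermat's little theorem

pos-^ : ∀ m n → + (m ℕ.^ n) ≡ (+ m) ^ n
pos-^ m zero    = refl
pos-^ m (suc n) = trans (ℤ.pos-* m (m ℕ.^ n)) (cong ((+ m) *_) (pos-^ m n))

^-∣-square : ∀ x r {y} → x ^ r ∣ y → x ^ (r ℕ.+ r) ∣ y * y
^-∣-square x r {y} (divides w y≡wxʳ) = divides (w * w) (begin
  y * y                   ≡⟨ cong₂ _*_ y≡wxʳ y≡wxʳ ⟩
  w * x ^ r * (w * x ^ r) ≡⟨ regroup w (x ^ r) ⟩
  w * w * (x ^ r * x ^ r) ≡⟨ cong (w * w *_) (ℤ.^-distribˡ-+-* x r r) ⟨
  w * w * x ^ (r ℕ.+ r)   ∎)
  where
  open ≡-Reasoning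
  regroup : ∀ w A → w * A * (w * A) ≡ w * w * (A * A)
  regroup = solve-∀

^-monoʳ-∣ : ∀ x {i j} → i ℕ.≤ j → x ^ i ∣ x ^ j
^-monoʳ-∣ x {i} {j} i≤j = divides (x ^ (j ℕ.∸ i))
  (trans (cong (x ^_) (sym (ℕ.m∸n+n≡m i≤j))) (ℤ.^-distribˡ-+-* x (j ℕ.∸ i) i))

≡mod-%ℕ : ∀ x n .{{_ : NonZero n}} → x ≡ + (x %ℕ n) mod + n
≡mod-%ℕ x n = mod∣ (divides (x /ℕ n) (trans (cong (_- r) (ℤ.a≡a%ℕn+[a/ℕn]*n x n)) (cancel r (x /ℕ n) (+ n))))
  where
  r = + (x %ℕ n)
  cancel : ∀ r q d → r + q * d - r ≡ q * d
  cancel = solve-∀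

∸1≡suc∸2 : ∀ n .{{_ : ℕ.NonTrivial n}} → n ℕ.∸ 1 ≡ suc (n ℕ.∸ 2)
∸1≡suc∸2 (suc (suc n)) = refl

n∣n! : ∀ n .{{_ : NonZero n}} → n ℕ.∣ n !
n∣n! (suc n) = ℕ.m∣m*n (n !)

^-≡mod-%ℕ : ∀ {x m} d N .{{_ : NonZero d}} → x ^ d ≡ 1ℤ mod m → x ^ N ≡ x ^ (N ℕ.% d) mod m
^-≡mod-%ℕ {x} {m} d N xᵈ≡1 = begin
  x ^ N                                  ≡⟨ cong (x ^_) (trans (ℕ.m≡m%n+[m/n]*n N d) (cong (N ℕ.% d ℕ.+_) (ℕ.*-comm (N ℕ./ d) d))) ⟩
  x ^ (N ℕ.% d ℕ.+ d ℕ.* (N ℕ./ d))      ≡⟨ ℤ.^-distribˡ-+-* x (N ℕ.% d) (d ℕ.* (N ℕ./ d)) ⟩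
  x ^ (N ℕ.% d) * x ^ (d ℕ.* (N ℕ./ d))  ≡⟨ cong (x ^ (N ℕ.% d) *_) (ℤ.^-*-assoc x d (N ℕ./ d)) ⟨
  x ^ (N ℕ.% d) * (x ^ d) ^ (N ℕ./ d)    ≈⟨ *-≡modˡ (x ^ (N ℕ.% d)) (^-≡mod (N ℕ./ d) xᵈ≡1) ⟩
  x ^ (N ℕ.% d) * 1ℤ ^ (N ℕ./ d)         ≡⟨ cong (x ^ (N ℕ.% d) *_) (ℤ.^-zeroˡ (N ℕ./ d)) ⟩
  x ^ (N ℕ.% d) * 1ℤ                     ≡⟨ ℤ.*-identityʳ _ ⟩
  x ^ (N ℕ.% d)                          ∎
  where open ≡mod-Reasoning m

binomialSum : ℕ → ℕ → ℕ → ℕ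
binomialSum n x zero    = 0
binomialSum n x (suc j) = binomialSum n x j ℕ.+ (n C j) ℕ.* x ℕ.^ j

nC0≡1 : ∀ n → n C 0 ≡ 1
nC0≡1 zero    = refl
nC0≡1 (suc n) = refl

binomialSum-pascal : ∀ n x j →
  binomialSum (suc n) x (suc j) ≡ binomialSum n x (suc j) ℕ.+ x ℕ.* binomialSum n x j
binomialSum-pascal n x zero rewrite nC0≡1 n | ℕ.*-zeroʳ x = refl
binomialSum-pascal n x (suc j) = begin
  binomialSum (suc n) x (suc j) ℕ.+ (suc n C suc j) ℕ.* (x ℕ.* x ℕ.^ j)
    ≡⟨ cong₂ ℕ._+_ (binomialSum-pascal n x j) (cong (ℕ._* (x ℕ.* x ℕ.^ j)) (sym (nCk+nC[k+1]≡[n+1]C[k+1] n j))) ⟩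
  (binomialSum n x (suc j) ℕ.+ x ℕ.* binomialSum n x j) ℕ.+ ((n C j) ℕ.+ (n C suc j)) ℕ.* (x ℕ.* x ℕ.^ j)
    ≡⟨ regroup (binomialSum n x (suc j)) (binomialSum n x j) (n C j) (n C suc j) (x ℕ.^ j) x ⟩
  (binomialSum n x (suc j) ℕ.+ (n C suc j) ℕ.* (x ℕ.* x ℕ.^ j)) ℕ.+ x ℕ.* (binomialSum n x j ℕ.+ (n C j) ℕ.* x ℕ.^ j) ∎
  where
  open ≡-Reasoning
  regroup : ∀ s s′ c c′ y x →
    (s ℕ.+ x ℕ.* s′) ℕ.+ (c ℕ.+ c′) ℕ.* (x ℕ.* y) ≡ (s ℕ.+ c′ ℕ.* (x ℕ.* y)) ℕ.+ x ℕ.* (s′ ℕ.+ c ℕ.* y)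
  regroup = ℕ-Solver.solve-∀

binomial-theorem : ∀ n x → (1 ℕ.+ x) ℕ.^ n ≡ binomialSum n x (suc n)
binomial-theorem zero    x = refl
binomial-theorem (suc n) x = begin
  (1 ℕ.+ x) ℕ.* (1 ℕ.+ x) ℕ.^ n                                            ≡⟨ cong ((1 ℕ.+ x) ℕ.*_) (binomial-theorem n x) ⟩
  (1 ℕ.+ x) ℕ.* binomialSum n x (suc n)                                   ≡⟨ expand (binomialSum n x (suc n)) (x ℕ.^ suc n) x ⟩
  binomialSum n x (suc n) ℕ.+ 0 ℕ.* x ℕ.^ suc n ℕ.+ x ℕ.* binomialSum n x (suc n)
    ≡⟨ cong (λ c → binomialSum n x (suc n) ℕ.+ c ℕ.* x ℕ.^ suc n ℕ.+ x ℕ.* binomialSum n x (suc n))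
            (sym (k>n⇒nCk≡0 (ℕ.n<1+n n))) ⟩
  binomialSum n x (suc (suc n)) ℕ.+ x ℕ.* binomialSum n x (suc n)         ≡⟨ binomialSum-pascal n x (suc n) ⟨
  binomialSum (suc n) x (suc (suc n))                                     ∎
  where
  open ≡-Reasoning
  expand : ∀ s y x → (1 ℕ.+ x) ℕ.* s ≡ s ℕ.+ 0 ℕ.* y ℕ.+ x ℕ.* s
  expand = ℕ-Solver.solve-∀

geometricSum : ℤ → ℕ → ℤ
geometricSum s zero    = 0ℤ
geometricSum s (suc j) = 1ℤ + s * geometricSum s j

geometricSum-identity : ∀ s j → s ^ j - 1ℤ ≡ (s - 1ℤ) * geometricSum s j
geometricSum-identity s zero    = vanish s
  where vanish : ∀ s → 1ℤ - 1ℤ ≡ (s - 1ℤ) * 0ℤ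
        vanish = solve-∀
geometricSum-identity s (suc j) = begin
  s * s ^ j - 1ℤ                                         ≡⟨ cong (λ y → s * y - 1ℤ) sʲ≡ ⟩
  s * ((s - 1ℤ) * geometricSum s j + 1ℤ) - 1ℤ            ≡⟨ step s (geometricSum s j) ⟩
  (s - 1ℤ) * (1ℤ + s * geometricSum s j)                 ∎
  where
  open ≡-Reasoning
  sʲ≡ : s ^ j ≡ (s - 1ℤ) * geometricSum s j + 1ℤ
  sʲ≡ = trans (shift (s ^ j)) (cong (_+ 1ℤ) (geometricSum-identity s j))
    where shift : ∀ y → y ≡ (y - 1ℤ) + 1ℤ
          shift = solve-∀
  step : ∀ s G → s * ((s - 1ℤ) * G + 1ℤ) - 1ℤ ≡ (s - 1ℤ) * (1ℤ + s * G)
  step = solve-∀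

geometricSum-≡mod : ∀ {m s} j → s ≡ 1ℤ mod m → geometricSum s j ≡ + j mod m
geometricSum-≡mod zero    _    = ≡mod-refl
geometricSum-≡mod {m} {s} (suc j) s≡1 = begin
  1ℤ + s * geometricSum s j  ≈⟨ +-≡modˡ 1ℤ (*-≡mod s≡1 (geometricSum-≡mod j s≡1)) ⟩
  1ℤ + 1ℤ * + j              ≡⟨ cong (λ y → 1ℤ + y) (ℤ.*-identityˡ (+ j)) ⟩
  1ℤ + + j                   ∎
  where open ≡mod-Reasoning m

binomial-truncated : ∀ n X → Σ ℤ λ Q → (1ℤ + X) ^ n ≡ 1ℤ + + n * X + + (n C 2) * (X * X) + X * X * X * Q
binomial-truncated zero    X = 0ℤ , expand X
  where expand : ∀ X → 1ℤ ≡ 1ℤ + 0ℤ * X + 0ℤ * (X * X) + X * X * X * 0ℤ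
        expand = solve-∀
binomial-truncated (suc n) X with binomial-truncated n X
... | Q , eq = + (n C 2) + Q + X * Q , (begin
  (1ℤ + X) * (1ℤ + X) ^ n                                                     ≡⟨ cong ((1ℤ + X) *_) eq ⟩
  (1ℤ + X) * (1ℤ + + n * X + + (n C 2) * (X * X) + X * X * X * Q)            ≡⟨ expand X (+ n) (+ (n C 2)) Q ⟩
  1ℤ + (1ℤ + + n) * X + (+ (n C 2) + + n) * (X * X) + X * X * X * (+ (n C 2) + Q + X * Q)
    ≡⟨ cong (λ c → 1ℤ + (1ℤ + + n) * X + c * (X * X) + X * X * X * (+ (n C 2) + Q + X * Q)) pascal ⟩
  1ℤ + + suc n * X + + (suc n C 2) * (X * X) + X * X * X * (+ (n C 2) + Q + X * Q) ∎)
  where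
  open ≡-Reasoning
  expand : ∀ X n c Q → (1ℤ + X) * (1ℤ + n * X + c * (X * X) + X * X * X * Q) ≡
                       1ℤ + (1ℤ + n) * X + (c + n) * (X * X) + X * X * X * (c + Q + X * Q)
  expand = solve-∀
  pascal : + (n C 2) + + n ≡ + (suc n C 2)
  pascal = trans (trans (ℤ.+-comm (+ (n C 2)) (+ n)) (cong (λ c → + c + + (n C 2)) (sym (nC1≡n n))))
                 (cong +_ (nCk+nC[k+1]≡[n+1]C[k+1] n 1))

^≡1+[e-1]n : ∀ n {e m} → m ∣ (e - 1ℤ) * (e - 1ℤ) → e ^ n ≡ 1ℤ + (e - 1ℤ) * + n mod m
^≡1+[e-1]n n {e} {m} m∣X² = mod∣ (subst (m ∣_) (sym remainder) (∣m⇒∣m*n _ m∣X²))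
  where
  X = e - 1ℤ
  Q = proj₁ (binomial-truncated n X)
  split : ∀ e → e ≡ 1ℤ + (e - 1ℤ)
  split = solve-∀
  collect : ∀ X n c Q → 1ℤ + n * X + c * (X * X) + X * X * X * Q - (1ℤ + X * n) ≡ X * X * (c + X * Q)
  collect = solve-∀
  remainder : e ^ n - (1ℤ + X * + n) ≡ X * X * (+ (n C 2) + X * Q)
  remainder = begin
    e ^ n - (1ℤ + X * + n)         ≡⟨ cong (λ y → y ^ n - (1ℤ + X * + n)) (split e) ⟩
    (1ℤ + X) ^ n - (1ℤ + X * + n)  ≡⟨ cong (_- (1ℤ + X * + n)) (proj₂ (binomial-truncated n X)) ⟩
    1ℤ + + n * X + + (n C 2) * (X * X) + X * X * X * Q - (1ℤ + X * + n) ≡⟨ collect X (+ n) (+ (n C 2)) Q ⟩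
    X * X * (+ (n C 2) + X * Q)    ∎
    where open ≡-Reasoning

module _ {p : ℕ} (p-prime : Prime p) where

  private
    P = + p
    instance p≢0 = prime⇒nonZero p-prime

  prime≢1 : p ≢ 1
  prime≢1 = ℕ.nonTrivial⇒≢1 {{prime⇒nonTrivial p-prime}}

  euclidsLemmaℤ : ∀ x y → P ∣ x * y → (P ∣ x) ⊎ (P ∣ y)
  euclidsLemmaℤ x y P∣xy with euclidsLemma ∣ x ∣ ∣ y ∣ p-prime (subst (p ℕ.∣_) (ℤ.abs-* x y) (∣⇒∣ᵤ P∣xy))
  ... | inj₁ p∣x = inj₁ (∣ᵤ⇒∣ p∣x)
  ... | inj₂ p∣y = inj₂ (∣ᵤ⇒∣ p∣y)

  prime∤^ : ∀ {x} n → ¬ P ∣ x → ¬ P ∣ x ^ n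
  prime∤^ zero    _   P∣1 = prime≢1 (ℕ.∣1⇒≡1 (∣⇒∣ᵤ P∣1))
  prime∤^ (suc n) P∤x P∣xxⁿ with euclidsLemmaℤ _ _ P∣xxⁿ
  ... | inj₁ P∣x  = P∤x P∣x
  ... | inj₂ P∣xⁿ = prime∤^ n P∤x P∣xⁿ

  prime∤* : ∀ {x y} → ¬ P ∣ x → ¬ P ∣ y → ¬ P ∣ x * y
  prime∤* P∤x P∤y P∣xy with euclidsLemmaℤ _ _ P∣xy
  ... | inj₁ P∣x = P∤x P∣x
  ... | inj₂ P∣y = P∤y P∣y

  ^-cancelˡ-∣ : ∀ i x → P ^ suc i ∣ P ^ i * x → P ∣ x
  ^-cancelˡ-∣ i x = *-cancelˡ-∣ (+ (p ℕ.^ i)) {{ℕ.m^n≢0 p i}} ∘ subst₂ _∣_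
    (trans (ℤ.*-comm P (P ^ i)) (cong (_* P) (sym (pos-^ p i))))
    (cong (_* x) (sym (pos-^ p i)))

  prime∤! : ∀ {i} → i ℕ.< p → ¬ p ℕ.∣ i !
  prime∤! {zero}  _   p∣1      = prime≢1 (ℕ.∣1⇒≡1 p∣1)
  prime∤! {suc i} i<p p∣[1+i]i! with euclidsLemma (suc i) (i !) p-prime p∣[1+i]i!
  ... | inj₁ p∣1+i = ℕ.<⇒≱ i<p (ℕ.∣⇒≤ p∣1+i)
  ... | inj₂ p∣i!  = prime∤! (ℕ.<-trans (ℕ.n<1+n i) i<p) p∣i!

  prime∣C : ∀ {j} → 0 ℕ.< j → j ℕ.< p → p ℕ.∣ p C j
  prime∣C {j} 0<j j<p
    with euclidsLemma (p C j) (j ! ℕ.* (p ℕ.∸ j) !) p-prime (subst (p ℕ.∣_) p!≡C*j![p-j]! (n∣n! p))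
    where
    instance _ = j ℕ.!* (p ℕ.∸ j) !≢0
    p!≡C*j![p-j]! : p ! ≡ (p C j) ℕ.* (j ! ℕ.* (p ℕ.∸ j) !)
    p!≡C*j![p-j]! = sym (trans (cong (ℕ._* (j ! ℕ.* (p ℕ.∸ j) !)) (nCk≡n!/k![n-k]! (ℕ.<⇒≤ j<p)))
                               (ℕ.m/n*n≡m (k![n∸k]!∣n! (ℕ.<⇒≤ j<p))))
  ... | inj₁ p∣C = p∣C
  ... | inj₂ p∣j![p-j]! with euclidsLemma (j !) ((p ℕ.∸ j) !) p-prime p∣j![p-j]!
  ...   | inj₁ p∣j!     = contradiction p∣j! (prime∤! j<p)
  ...   | inj₂ p∣[p-j]! = contradiction p∣[p-j]! (prime∤! (ℕ.∸-monoʳ-< 0<j (ℕ.<⇒≤ j<p)))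

  binomialSum≡1 : ∀ x {j} → 0 ℕ.< j → j ℕ.≤ p → + binomialSum p x j ≡ 1ℤ mod P
  binomialSum≡1 x {suc zero}    _ _   = ≡⇒≡mod (cong (λ c → + (c ℕ.* 1)) (nC0≡1 p))
  binomialSum≡1 x {suc (suc j)} _ j<p = begin
    + (s ℕ.+ t)  ≡⟨ ℤ.pos-+ s t ⟩
    + s + + t    ≈⟨ +-≡mod {x = + s} {u = + t} (binomialSum≡1 x (ℕ.s≤s ℕ.z≤n) (ℕ.<⇒≤ j<p))
                                                (∣⇒≡mod0 (∣ᵤ⇒∣ p∣t)) ⟩
    1ℤ + 0ℤ      ≡⟨ ℤ.+-identityʳ 1ℤ ⟩
    1ℤ           ∎
    where
    open ≡mod-Reasoning P
    s = binomialSum p x (suc j)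
    t = (p C suc j) ℕ.* x ℕ.^ suc j
    p∣t : p ℕ.∣ t
    p∣t = ℕ.∣m⇒∣m*n _ (prime∣C (ℕ.s≤s ℕ.z≤n) j<p)

  fermat-ℕ : ∀ x → (+ x) ^ p ≡ + x mod P
  fermat-ℕ zero    = ≡⇒≡mod (0^n≡0 p)
    where 0^n≡0 : ∀ n .{{_ : NonZero n}} → 0ℤ ^ n ≡ 0ℤ
          0^n≡0 (suc n) = refl
  fermat-ℕ (suc x) = begin
    (+ suc x) ^ p                    ≡⟨ pos-^ (suc x) p ⟨
    + ((1 ℕ.+ x) ℕ.^ p)              ≡⟨ cong +_ (binomial-theorem p x) ⟩
    + (s ℕ.+ (p C p) ℕ.* x ℕ.^ p)    ≡⟨ cong (λ c → + (s ℕ.+ c ℕ.* x ℕ.^ p)) (nCn≡1 p) ⟩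
    + (s ℕ.+ 1 ℕ.* x ℕ.^ p)          ≡⟨ ℤ.pos-+ s (1 ℕ.* x ℕ.^ p) ⟩
    + s + + (1 ℕ.* x ℕ.^ p)          ≈⟨ +-≡mod {x = + s} {y = 1ℤ} (binomialSum≡1 x (ℕ.>-nonZero⁻¹ p) ℕ.≤-refl)
                                                                 (≡⇒≡mod xᵖ≡) ⟩
    1ℤ + (+ x) ^ p                   ≈⟨ +-≡modˡ 1ℤ (fermat-ℕ x) ⟩
    1ℤ + + x                         ∎
    where
    open ≡mod-Reasoning P
    s = binomialSum p x p
    xᵖ≡ : + (1 ℕ.* x ℕ.^ p) ≡ (+ x) ^ p
    xᵖ≡ = trans (cong +_ (ℕ.*-identityˡ _)) (pos-^ x p)

  fermat : ∀ x → x ^ p ≡ x mod P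
  fermat x = begin
    x ^ p                 ≈⟨ ^-≡mod p (≡mod-%ℕ x p) ⟩
    (+ (x %ℕ p)) ^ p      ≈⟨ fermat-ℕ (x %ℕ p) ⟩
    + (x %ℕ p)            ≈⟨ ≡mod-%ℕ x p ⟨
    x                     ∎
    where open ≡mod-Reasoning P

  fermat-unit : ∀ {x} → ¬ P ∣ x → x ^ (p ℕ.∸ 1) ≡ 1ℤ mod P
  fermat-unit {x} P∤x =
    [ flip contradiction P∤x , mod∣ ]′ (euclidsLemmaℤ x (x ^ (p ℕ.∸ 1) - 1ℤ) P∣x[xᵖ⁻¹-1])
    where
    pull-out : ∀ x y → x * y - x ≡ x * (y - 1ℤ)
    pull-out = solve-∀
    P∣x[xᵖ⁻¹-1] : P ∣ x * (x ^ (p ℕ.∸ 1) - 1ℤ)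
    P∣x[xᵖ⁻¹-1] = subst (P ∣_)
      (trans (cong (λ n → x ^ n - x) (sym (ℕ.suc-pred p))) (pull-out x (x ^ (p ℕ.∸ 1))))
      (∣-diff (fermat x))

  -- sʲ - 1 = (s - 1)·(1 + s + ⋯ + sʲ⁻¹), and the second factor is ≡ j ≢ 0 (mod p).
  ≡1-lift : ∀ {s} j r → ¬ p ℕ.∣ j → s ≡ 1ℤ mod P → s ^ j ≡ 1ℤ mod P ^ r → s ≡ 1ℤ mod P ^ r
  ≡1-lift {s} j r p∤j s≡1 sʲ≡1 = go r ℕ.≤-refl
    where
    P∤G : ¬ P ∣ geometricSum s j
    P∤G P∣G = p∤j (∣⇒∣ᵤ (≡mod0⇒∣ (≡mod-trans (≡mod-sym (geometricSum-≡mod j s≡1)) (∣⇒≡mod0 P∣G))))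

    step : ∀ {i} → s ≡ 1ℤ mod P ^ i → s ^ j ≡ 1ℤ mod P ^ suc i → s ≡ 1ℤ mod P ^ suc i
    step {i} (mod∣ (divides w s-1≡wPⁱ)) (mod∣ Pⁱ⁺¹∣sʲ-1) = [ P∣w⇒ , flip contradiction P∤G ]′ (euclidsLemmaℤ w G P∣wG)
      where
      G = geometricSum s j
      regroup : ∀ w A G → w * A * G ≡ A * (w * G)
      regroup = solve-∀
      P∣wG : P ∣ w * G
      P∣wG = ^-cancelˡ-∣ i (w * G) (subst (P ^ suc i ∣_)
        (trans (geometricSum-identity s j) (trans (cong (_* G) s-1≡wPⁱ) (regroup w (P ^ i) G))) Pⁱ⁺¹∣sʲ-1)
      P∣w⇒ : P ∣ w → s ≡ 1ℤ mod P ^ suc i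
      P∣w⇒ (divides c w≡cP) = mod∣ (divides c (trans s-1≡wPⁱ (trans (cong (_* P ^ i) w≡cP) (ℤ.*-assoc c P (P ^ i)))))

    go : ∀ i → i ℕ.≤ r → s ≡ 1ℤ mod P ^ i
    go zero    _   = mod∣ (divides (s - 1ℤ) (sym (ℤ.*-identityʳ _)))
    go (suc i) i<r = step {i} (go i (ℕ.<⇒≤ i<r)) (≡mod-weaken (^-monoʳ-∣ P i<r) sʲ≡1)

  private
    Pʳ*Pʳ : ∀ r → P ^ r * P ^ r ≡ P ^ (r ℕ.+ r)
    Pʳ*Pʳ r = sym (ℤ.^-distribˡ-+-* P r r)

  P^[2+r]∣C*P^2r : ∀ {r} → 1 ℕ.≤ r → (p ≡ 2 → 2 ℕ.≤ r) → P ^ (2 ℕ.+ r) ∣ + (p C 2) * (P ^ r * P ^ r)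
  P^[2+r]∣C*P^2r {r} r≥1 r≥2 with p ℕ.≟ 2
  ... | yes p≡2 = subst (λ c → P ^ (2 ℕ.+ r) ∣ c * (P ^ r * P ^ r)) (sym (cong (λ q → + (q C 2)) p≡2))
                    (∣n⇒∣m*n 1ℤ (subst (P ^ (2 ℕ.+ r) ∣_) (sym (Pʳ*Pʳ r)) (^-monoʳ-∣ P (ℕ.+-monoˡ-≤ r (r≥2 p≡2)))))
  ... | no  p≢2 with prime∣C (ℕ.s≤s ℕ.z≤n) (ℕ.≤∧≢⇒< (ℕ.nonTrivial⇒n>1 p {{prime⇒nonTrivial p-prime}}) (p≢2 ∘ sym))
  ...   | ℕ.divides c C≡cp = subst (P ^ (2 ℕ.+ r) ∣_) (sym C*P^2r≡) (∣n⇒∣m*n (+ c) (^-monoʳ-∣ P (ℕ.s≤s (ℕ.+-monoˡ-≤ r r≥1))))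
    where
    C*P^2r≡ : + (p C 2) * (P ^ r * P ^ r) ≡ + c * P ^ suc (r ℕ.+ r)
    C*P^2r≡ = trans (cong₂ _*_ (trans (cong +_ C≡cp) (ℤ.pos-* c p)) (Pʳ*Pʳ r)) (ℤ.*-assoc (+ c) P _)

  P^[2+r]∣P^3r : ∀ {r} → 1 ℕ.≤ r → P ^ (2 ℕ.+ r) ∣ P ^ r * P ^ r * P ^ r
  P^[2+r]∣P^3r {r} r≥1 = subst (P ^ (2 ℕ.+ r) ∣_) (trans (ℤ.^-distribˡ-+-* P (r ℕ.+ r) r) (cong (_* P ^ r) (sym (Pʳ*Pʳ r))))
                           (^-monoʳ-∣ P (ℕ.+-monoˡ-≤ r (ℕ.+-mono-≤ r≥1 r≥1)))

  ^p-raises-valuation : ∀ {r h e} → 1 ℕ.≤ r → (p ≡ 2 → 2 ℕ.≤ r) →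
    e ≡ 1ℤ + h * P ^ r mod P ^ suc r → e ^ p ≡ 1ℤ + h * P ^ suc r mod P ^ suc (suc r)
  ^p-raises-valuation {r} {h} {e} r≥1 r≥2 e≡1+hA =
    mod∣ (subst (P ^ suc (suc r) ∣_) (sym expansion)
      (∣m∣n⇒∣m+n (∣m∣n⇒∣m+n (∣n⇒∣m*n w ∣-refl) (∣m⇒∣m*n (t * t) (P^[2+r]∣C*P^2r r≥1 r≥2)))
                  (∣m⇒∣m*n (t * t * t * Q) (P^[2+r]∣P^3r r≥1))))
    where
    A = P ^ r
    w = quotient (∣-diff e≡1+hA)
    t = h + w * P
    X = e - 1ℤ
    Q = proj₁ (binomial-truncated p X)
    split : ∀ e → e ≡ 1ℤ + (e - 1ℤ)
    split = solve-∀
    collect : ∀ P A h w c Q → let y = h * A + w * (P * A) ; t = h + w * P in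
      1ℤ + P * y + c * (y * y) + y * y * y * Q - (1ℤ + h * (P * A)) ≡
      w * (P * (P * A)) + c * (A * A) * (t * t) + A * A * A * (t * t * t * Q)
    collect = solve-∀
    expansion : e ^ p - (1ℤ + h * (P * A)) ≡ w * (P * (P * A)) + + (p C 2) * (A * A) * (t * t) + A * A * A * (t * t * t * Q)
    expansion = begin
      e ^ p - (1ℤ + h * (P * A))         ≡⟨ cong (λ y → y ^ p - (1ℤ + h * (P * A))) (split e) ⟩
      (1ℤ + X) ^ p - (1ℤ + h * (P * A))  ≡⟨ cong (_- (1ℤ + h * (P * A))) (proj₂ (binomial-truncated p X)) ⟩
      1ℤ + P * X + + (p C 2) * (X * X) + X * X * X * Q - (1ℤ + h * (P * A))
        ≡⟨ cong (λ y → 1ℤ + P * y + + (p C 2) * (y * y) + y * y * y * Q - (1ℤ + h * (P * A))) (≡1+x⇒-1≡ {e} {h * A} e≡1+hA) ⟩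
      1ℤ + P * y + + (p C 2) * (y * y) + y * y * y * Q - (1ℤ + h * (P * A))
        ≡⟨ collect P A h w (+ (p C 2)) Q ⟩
      w * (P * (P * A)) + + (p C 2) * (A * A) * (t * t) + A * A * A * (t * t * t * Q) ∎
      where
      open ≡-Reasoning
      y = h * A + w * (P * A)

  p∤p-1 : ¬ p ℕ.∣ p ℕ.∸ 1
  p∤p-1 = ℕ.>⇒∤ {{p-1≢0}} (ℕ.∸-monoʳ-< {n = 1} {o = 0} ℕ.z<s (ℕ.>-nonZero⁻¹ p))
    where p-1≢0 = ℕ.≢-nonZero (ℕ.m>n⇒m∸n≢0 (ℕ.nonTrivial⇒n>1 p {{prime⇒nonTrivial p-prime}}))

  ^-≡mod-lift-≤ : ∀ {x} r {n₁ n₂} → n₂ ℕ.≤ n₁ → ¬ P ∣ x → x ^ (p ℕ.∸ 1) ≡ 1ℤ mod P ^ r →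
                  x ^ n₁ ≡ x ^ n₂ mod P → x ^ n₁ ≡ x ^ n₂ mod P ^ r
  ^-≡mod-lift-≤ {x} r {n₁} {n₂} n₂≤n₁ P∤x xᵖ⁻¹≡1 xⁿ¹≡xⁿ² = begin
    x ^ n₁        ≡⟨ xⁿ¹≡xⁿ²s ⟩
    x ^ n₂ * s    ≈⟨ *-≡modˡ (x ^ n₂) s≡1 ⟩
    x ^ n₂ * 1ℤ   ≡⟨ ℤ.*-identityʳ _ ⟩
    x ^ n₂        ∎
    where
    open ≡mod-Reasoning (P ^ r)
    t = n₁ ℕ.∸ n₂
    s = x ^ t
    xⁿ¹≡xⁿ²s : x ^ n₁ ≡ x ^ n₂ * s
    xⁿ¹≡xⁿ²s = trans (cong (x ^_) (sym (ℕ.m+[n∸m]≡n n₂≤n₁))) (ℤ.^-distribˡ-+-* x n₂ t)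
    pull-out : ∀ y s → y * s - y ≡ y * (s - 1ℤ)
    pull-out = solve-∀
    s≡1[P] : s ≡ 1ℤ mod P
    s≡1[P] = [ flip contradiction (prime∤^ n₂ P∤x) , mod∣ ]′
      (euclidsLemmaℤ (x ^ n₂) (s - 1ℤ) (subst (P ∣_) (trans (cong (_- x ^ n₂) xⁿ¹≡xⁿ²s) (pull-out (x ^ n₂) s)) (∣-diff xⁿ¹≡xⁿ²)))
    sᵖ⁻¹≡1 : s ^ (p ℕ.∸ 1) ≡ 1ℤ mod P ^ r
    sᵖ⁻¹≡1 = begin
      (x ^ t) ^ (p ℕ.∸ 1)     ≡⟨ ℤ.^-*-assoc x t (p ℕ.∸ 1) ⟩
      x ^ (t ℕ.* (p ℕ.∸ 1))   ≡⟨ cong (x ^_) (ℕ.*-comm t (p ℕ.∸ 1)) ⟩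
      x ^ ((p ℕ.∸ 1) ℕ.* t)   ≡⟨ ℤ.^-*-assoc x (p ℕ.∸ 1) t ⟨
      (x ^ (p ℕ.∸ 1)) ^ t     ≈⟨ ^-≡mod t xᵖ⁻¹≡1 ⟩
      1ℤ ^ t                  ≡⟨ ℤ.^-zeroˡ t ⟩
      1ℤ                      ∎
    s≡1 : s ≡ 1ℤ mod P ^ r
    s≡1 = ≡1-lift (p ℕ.∸ 1) r p∤p-1 s≡1[P] sᵖ⁻¹≡1

  ^-≡mod-lift : ∀ {x} r n₁ n₂ → ¬ P ∣ x → x ^ (p ℕ.∸ 1) ≡ 1ℤ mod P ^ r → x ^ n₁ ≡ x ^ n₂ mod P → x ^ n₁ ≡ x ^ n₂ mod P ^ r
  ^-≡mod-lift r n₁ n₂ P∤x xᵖ⁻¹≡1 xⁿ¹≡xⁿ² with ℕ.≤-total n₂ n₁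
  ... | inj₁ n₂≤n₁ = ^-≡mod-lift-≤ r n₂≤n₁ P∤x xᵖ⁻¹≡1 xⁿ¹≡xⁿ²
  ... | inj₂ n₁≤n₂ = ≡mod-sym (^-≡mod-lift-≤ r n₁≤n₂ P∤x xᵖ⁻¹≡1 (≡mod-sym xⁿ¹≡xⁿ²))

-- Residues and the arithmetic helpers of DLL

Residue : ℕ → ℤ → Set
Residue m x = Σ ℕ λ X → x ≡ + X × X ℕ.< m

residue-unique : ∀ {m x y} → Residue m x → Residue m y → x ≡ y mod + m → x ≡ y
residue-unique {m} (X , refl , X<m) (Y , refl , Y<m) (mod∣ m∣X-Y) =
  ℤ.i-j≡0⇒i≡j (+ X) (+ Y) (ℤ.∣i∣≡0⇒i≡0 (small-multiple _ (∣⇒∣ᵤ m∣X-Y) ∣X-Y∣<m))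
  where
  small-multiple : ∀ n → m ℕ.∣ n → n ℕ.< m → n ≡ 0
  small-multiple zero    _   _   = refl
  small-multiple (suc n) m∣n n<m = contradiction m∣n (ℕ.>⇒∤ n<m)
  ∣X-Y∣<m : ∣ + X - + Y ∣ ℕ.< m
  ∣X-Y∣<m = ℕ.≤-<-trans (subst (ℕ._≤ X ℕ.⊔ Y) (cong ∣_∣ (sym (ℤ.m-n≡m⊖n X Y))) (ℤ.∣m⊝n∣≤m⊔n X Y)) (ℕ.⊔-lub X<m Y<m)

modZ-residue : ∀ u n .{{_ : NonZero n}} → Residue n (modZ u n)
modZ-residue u (suc n) = u %ℕ suc n , refl , ℤ.n%ℕd<d u (suc n)

modZ-≡mod : ∀ u n .{{_ : NonZero n}} → modZ u n ≡ u mod + n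
modZ-≡mod u (suc n) = ≡mod-sym (≡mod-%ℕ u (suc n))

∣⇒%ℕ≡0 : ∀ {u} n .{{_ : NonZero n}} → + n ∣ u → u %ℕ n ≡ 0
∣⇒%ℕ≡0 {u} (suc n) n∣u = ℤ.+-injective (residue-unique (modZ-residue u (suc n)) (0 , refl , ℕ.z<s)
                           (≡mod-trans (modZ-≡mod u (suc n)) (∣⇒≡mod0 n∣u)))

%ℕ≡0⇒≡/ℕ* : ∀ u n .{{_ : NonZero n}} → u %ℕ n ≡ 0 → u ≡ (u /ℕ n) * + n
%ℕ≡0⇒≡/ℕ* u n r≡0 = trans (ℤ.a≡a%ℕn+[a/ℕn]*n u n) (trans (cong (λ r → + r + (u /ℕ n) * + n) r≡0) (ℤ.+-identityˡ _))

divZ-exact : ∀ {u} n .{{_ : NonZero n}} → + n ∣ u → u ≡ divZ u n * + n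
divZ-exact {u} (suc n) n∣u = %ℕ≡0⇒≡/ℕ* u (suc n) (∣⇒%ℕ≡0 (suc n) n∣u)

dividesB-reflects : ∀ n u .{{_ : NonZero n}} → Reflects (+ n ∣ u) (dividesB n u)
dividesB-reflects (suc n) u = subst (Reflects _) (sym (isYes≗does ((u %ℕ suc n) ℕ.≟ 0)))
  (proof (map′ (divides (u /ℕ suc n) ∘ %ℕ≡0⇒≡/ℕ* u (suc n)) (∣⇒%ℕ≡0 (suc n)) ((u %ℕ suc n) ℕ.≟ 0)))

record Stripped (p j : ℕ) (x h : ℤ) (r : ℕ) : Set where
  field
    r≤j    : r ℕ.≤ j
    x≡hpʳ  : x ≡ h * (+ p) ^ r
    p∤h    : r ℕ.< j → ¬ + p ∣ h

strip-spec : ∀ p j x .{{_ : NonZero p}} → Stripped p j x (proj₁ (strip p j x)) (proj₂ (strip p j x))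
strip-spec p zero    x = record { r≤j = ℕ.z≤n ; x≡hpʳ = sym (ℤ.*-identityʳ x) ; p∤h = λ () }
strip-spec p (suc j) x with dividesB p x | dividesB-reflects p x
... | false | ofⁿ p∤x = record { r≤j = ℕ.z≤n ; x≡hpʳ = sym (ℤ.*-identityʳ x) ; p∤h = λ _ → p∤x }
... | true  | ofʸ p∣x with strip p j (divZ x p) | strip-spec p j (divZ x p)
...   | h , r | record { r≤j = r≤j ; x≡hpʳ = x/p≡hpʳ ; p∤h = p∤h } =
  record { r≤j = ℕ.s≤s r≤j ; x≡hpʳ = x≡hp¹⁺ʳ ; p∤h = p∤h ∘ ℕ.s≤s⁻¹ }
  where
  regroup : ∀ h P Pʳ → h * Pʳ * P ≡ h * (P * Pʳ)
  regroup = solve-∀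
  x≡hp¹⁺ʳ : x ≡ h * (+ p) ^ suc r
  x≡hp¹⁺ʳ = trans (divZ-exact p p∣x) (trans (cong (_* + p) x/p≡hpʳ) (regroup h (+ p) ((+ p) ^ r)))

module _ {p : ℕ} (p-prime : Prime p) where

  private instance p≢0 = prime⇒nonZero p-prime

  strip-maximal : ∀ {k x i} → (+ p) ^ i ∣ x → proj₂ (strip p k x) ℕ.< k → i ℕ.≤ proj₂ (strip p k x)
  strip-maximal {k} {x} pⁱ∣x r<k = ℕ.≮⇒≥ λ r<i →
    p∤h r<k (^-cancelˡ-∣ p-prime r h (subst ((+ p) ^ suc r ∣_) x≡pʳh (∣-trans (^-monoʳ-∣ (+ p) r<i) pⁱ∣x)))
    where
    open Stripped (strip-spec p k x)
    h = proj₁ (strip p k x)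
    r = proj₂ (strip p k x)
    x≡pʳh : x ≡ (+ p) ^ r * h
    x≡pʳh = trans x≡hpʳ (ℤ.*-comm h _)

-- The digit loop

module Algorithm {p : ℕ} (p-prime : Prime p) (k : ℕ) where

  P = + p
  m = p ℕ.^ k
  M = + m
  p-1 = p ℕ.∸ 1

  private instance
    p≢0 = prime⇒nonZero p-prime
    m≢0 = ℕ.m^n≢0 p k

  M≡Pᵏ : M ≡ P ^ k
  M≡Pᵏ = pos-^ p k

  Pʲ∣M : ∀ {j} → j ℕ.≤ k → P ^ j ∣ M
  Pʲ∣M {j} j≤k = subst (P ^ j ∣_) (sym M≡Pᵏ) (^-monoʳ-∣ P j≤k)

  ≡modM⇒≡modPʲ : ∀ {j x y} → j ℕ.≤ k → x ≡ y mod M → x ≡ y mod P ^ j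
  ≡modM⇒≡modPʲ = ≡mod-weaken ∘ Pʲ∣M

  -- The pair (f , e) produced by one round of `loopBody`, spelled out so that its projections are
  -- definitionally the factor and the new e of the loop.
  stepFactors : ℕ → ℤ → ℤ → ℤ × ℤ
  stepFactors r e d =
    if ⌊ k ℕ.≤? 2 ℕ.* r ⌋
      then (modZ (1ℤ + (e - 1ℤ) * d) m , modZ (1ℤ + (e - 1ℤ) * + p) m)
      else (let f = modZ (e ^ ∣ d ∣) m in f , modZ (f * e ^ (p ℕ.∸ ∣ d ∣)) m)

  record StepFactors (r : ℕ) (e : ℤ) (D : ℕ) (f e′ : ℤ) : Set where
    field
      f≡eᴰ       : f ≡ e ^ D mod M
      f≡1+[e-1]D : f ≡ 1ℤ + (e - 1ℤ) * + D mod P ^ suc r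
      e′≡eᵖ      : e′ ≡ e ^ p mod M

  stepFactors-spec : ∀ {r e} D → P ^ r ∣ e - 1ℤ → 1 ℕ.≤ r → r ℕ.< k → D ℕ.≤ p →
    StepFactors r e D (proj₁ (stepFactors r e (+ D))) (proj₂ (stepFactors r e (+ D)))
  stepFactors-spec {r} {e} D Pʳ∣e-1 r≥1 r<k D≤p with k ℕ.≤? 2 ℕ.* r
  ... | yes k≤2r = record
    { f≡eᴰ       = ≡mod-trans (modZ-≡mod _ m) (≡mod-sym (^≡1+[e-1]n D M∣[e-1]²))
    ; f≡1+[e-1]D = ≡modM⇒≡modPʲ r<k (modZ-≡mod _ m)
    ; e′≡eᵖ      = ≡mod-trans (modZ-≡mod _ m) (≡mod-sym (^≡1+[e-1]n p M∣[e-1]²))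
    }
    where
    M∣[e-1]² : M ∣ (e - 1ℤ) * (e - 1ℤ)
    M∣[e-1]² = ∣-trans (subst (_∣ P ^ (r ℕ.+ r)) (sym M≡Pᵏ) (^-monoʳ-∣ P k≤r+r)) (^-∣-square P r Pʳ∣e-1)
      where k≤r+r = subst (k ℕ.≤_) (cong (r ℕ.+_) (ℕ.+-identityʳ r)) k≤2r
  ... | no _ = record
    { f≡eᴰ       = modZ-≡mod _ m
    ; f≡1+[e-1]D = ≡mod-trans (≡modM⇒≡modPʲ r<k (modZ-≡mod _ m))
                     (≡mod-weaken (^-monoʳ-∣ P (ℕ.+-monoˡ-≤ r r≥1)) (^≡1+[e-1]n D (^-∣-square P r Pʳ∣e-1)))
    ; e′≡eᵖ      = ≡mod-trans (modZ-≡mod _ m) (≡mod-trans (*-≡modʳ (e ^ (p ℕ.∸ D)) (modZ-≡mod _ m)) (≡⇒≡mod eᴰeᵖ⁻ᴰ≡eᵖ))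
    }
    where
    eᴰeᵖ⁻ᴰ≡eᵖ : e ^ D * e ^ (p ℕ.∸ D) ≡ e ^ p
    eᴰeᵖ⁻ᴰ≡eᵖ = trans (sym (ℤ.^-distribˡ-+-* e D (p ℕ.∸ D))) (cong (e ^_) (ℕ.m+[n∸m]≡n D≤p))

  module Loop (a b h : ℤ) (z′ : ℕ) (b-residue : Residue m b) (P∤b : 0 ℕ.< k → ¬ P ∣ b) where

    g : ℤ
    g = modZ ((h * b) ^ (p ℕ.∸ 2)) p

    -- r and h are ν_p(e - 1) and (e - 1)/pʳ (mod p); the bounds on r are those under which
    -- raising e to the p-th power raises the valuation by exactly one.
    record Valuation (r : ℕ) (e : ℤ) : Set where
      field
        P∤h     : ¬ P ∣ h
        r≥1     : 1 ℕ.≤ r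
        r≥2     : p ≡ 2 → 2 ℕ.≤ r
        e≡1+hPʳ : e ≡ 1ℤ + h * P ^ r mod P ^ suc r

    Valuation⇒Pʳ∣e-1 : ∀ {r e} → Valuation r e → P ^ r ∣ e - 1ℤ
    Valuation⇒Pʳ∣e-1 {r} {e} valuation = subst (P ^ r ∣_) (sym (≡1+x⇒-1≡ {e} {h * P ^ r} e≡1+hPʳ))
      (∣m∣n⇒∣m+n (∣n⇒∣m*n h ∣-refl) (∣n⇒∣m*n (quotient (∣-diff e≡1+hPʳ)) (^-monoʳ-∣ P (ℕ.n≤1+n r))))
      where open Valuation valuation

    -- g ≡ (h·b)⁻¹ (mod p) by Fermat's little theorem, and c ≡ b (mod p).
    digit-inverts : ∀ {r c q D} → 1 ℕ.≤ r → r ℕ.< k → ¬ P ∣ h → b - c ≡ q * P ^ r → + D ≡ g * q mod P →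
                    c * + D * h ≡ q mod P
    digit-inverts {r} {c} {q} {D} r≥1 r<k P∤h b-c≡qPʳ D≡gq = begin
      c * + D * h                          ≈⟨ *-≡modʳ h (*-≡mod c≡b D≡gq) ⟩
      b * (g * q) * h                      ≈⟨ *-≡modʳ h (*-≡modˡ b (*-≡modʳ q (modZ-≡mod _ p))) ⟩
      b * ((h * b) ^ (p ℕ.∸ 2) * q) * h    ≡⟨ regroup b ((h * b) ^ (p ℕ.∸ 2)) q h ⟩
      (h * b) ^ suc (p ℕ.∸ 2) * q          ≡⟨ cong (λ n → (h * b) ^ n * q) (∸1≡suc∸2 p {{prime⇒nonTrivial p-prime}}) ⟨
      (h * b) ^ p-1 * q              ≈⟨ *-≡modʳ q (fermat-unit p-prime (prime∤* p-prime P∤h (P∤b (ℕ.≤-<-trans ℕ.z≤n r<k)))) ⟩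
      1ℤ * q                               ≡⟨ ℤ.*-identityˡ q ⟩
      q                                    ∎
      where
      open ≡mod-Reasoning P
      regroup : ∀ b X q h → b * (X * q) * h ≡ h * b * X * q
      regroup = solve-∀
      c≡b : c ≡ b mod P
      c≡b = ≡mod-sym (mod∣ (∣-trans (subst (_∣ P ^ r) (ℤ.^-identityʳ P) (^-monoʳ-∣ P r≥1)) (divides q b-c≡qPʳ)))

    digit-clears : ∀ {r c e q D} → r ℕ.< k → Valuation r e → b - c ≡ q * P ^ r → + D ≡ g * q mod P →
                   P ^ suc r ∣ b - c * (1ℤ + (e - 1ℤ) * + D)
    digit-clears {r} {c} {e} {q} {D} r<k valuation b-c≡qPʳ D≡gq = divides (j - c * + D * w) (begin
      b - c * (1ℤ + (e - 1ℤ) * + D)              ≡⟨ regroup₁ b c e (+ D) ⟩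
      (b - c) - c * + D * (e - 1ℤ)                ≡⟨ cong₂ (λ x y → x - c * + D * y) b-c≡qPʳ (≡1+x⇒-1≡ {e} {h * P ^ r} e≡1+hPʳ) ⟩
      q * A - c * + D * (h * A + w * (P * A))     ≡⟨ regroup₂ q A c (+ D) h w P ⟩
      A * (q - c * + D * h) - c * + D * w * (P * A) ≡⟨ cong (λ x → A * x - c * + D * w * (P * A)) q-cDh≡jP ⟩
      A * (j * P) - c * + D * w * (P * A)         ≡⟨ regroup₃ A j P c (+ D) w ⟩
      (j - c * + D * w) * (P * A)                 ∎)
      where
      open ≡-Reasoning
      open Valuation valuation
      A = P ^ r
      w = quotient (∣-diff e≡1+hPʳ)
      q-cDh = ∣-diff (≡mod-sym (digit-inverts r≥1 r<k P∤h b-c≡qPʳ D≡gq))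
      j = quotient q-cDh
      q-cDh≡jP = _∣_.equality q-cDh
      regroup₁ : ∀ b c e D → b - c * (1ℤ + (e - 1ℤ) * D) ≡ (b - c) - c * D * (e - 1ℤ)
      regroup₁ = solve-∀
      regroup₂ : ∀ q A c D h w P → q * A - c * D * (h * A + w * (P * A)) ≡ A * (q - c * D * h) - c * D * w * (P * A)
      regroup₂ = solve-∀
      regroup₃ : ∀ A j P c D w → A * (j * P) - c * D * w * (P * A) ≡ (j - c * D * w) * (P * A)
      regroup₃ = solve-∀

    record Invariant (s : LoopState) : Set where
      field
        exponent  : ℕ
        y≡        : LoopState.y s ≡ + exponent
        c≡aˣ      : LoopState.c s ≡ a ^ (p-1 ℕ.* exponent ℕ.+ z′) mod M
        c-residue : Residue m (LoopState.c s)
        e≡aᵘ      : LoopState.e s ≡ a ^ (p-1 ℕ.* LoopState.u s) mod M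
        v≡pʳ      : LoopState.v s ≡ p ℕ.^ LoopState.r s
        r≤k       : LoopState.r s ℕ.≤ k
        Pʳ∣b-c    : P ^ LoopState.r s ∣ b - LoopState.c s
        valuation : LoopState.r s ℕ.< k → Valuation (LoopState.r s) (LoopState.e s)

    invariant-step′ : ∀ {y u v r e c} d D → d ≡ + D → D ℕ.< p → d ≡ g * divZ (b - c) v mod P →
      Invariant (st y u v r e c) → r ℕ.< k →
      Invariant (st (y + d * + u) (u ℕ.* p) (v ℕ.* p) (suc r)
                    (proj₂ (stepFactors r e d)) (modZ (c * proj₁ (stepFactors r e d)) m))
    invariant-step′ {y} {u} {v} {r} {e} {c} .(+ D) D refl D<p D≡gq inv r<k = record
      { exponent  = exponent ℕ.+ D ℕ.* u
      ; y≡        = y′≡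
      ; c≡aˣ      = c′≡aˣ
      ; c-residue = modZ-residue _ m
      ; e≡aᵘ      = ≡mod-trans e′≡eᵖ (≡mod-trans (^-≡mod p e≡aᵘ) (≡⇒≡mod [aᵘ]ᵖ≡))
      ; v≡pʳ      = trans (cong (ℕ._* p) v≡pʳ) (ℕ.*-comm (p ℕ.^ r) p)
      ; r≤k       = r<k
      ; Pʳ∣b-c    = Pʳ⁺¹∣b-c′
      ; valuation = λ r+1<k → record
        { P∤h     = P∤h
        ; r≥1     = ℕ.s≤s ℕ.z≤n
        ; r≥2     = ℕ.m≤n⇒m≤1+n ∘ r≥2
        ; e≡1+hPʳ = ≡mod-trans (≡modM⇒≡modPʲ r+1<k e′≡eᵖ)
                               (^p-raises-valuation p-prime {r} {h} {e} r≥1 r≥2 e≡1+hPʳ)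
        }
      }
      where
      open Invariant inv
      open Valuation (valuation r<k)
      q = divZ (b - c) v
      open StepFactors (stepFactors-spec {r} {e} D (Valuation⇒Pʳ∣e-1 (valuation r<k)) r≥1 r<k (ℕ.<⇒≤ D<p))
      b-c≡qPʳ : b - c ≡ q * P ^ r
      b-c≡qPʳ = trans (divZ-exact v {{v≢0}} (subst (_∣ b - c) Pʳ≡v Pʳ∣b-c)) (cong (q *_) (sym Pʳ≡v))
        where
        Pʳ≡v : P ^ r ≡ + v
        Pʳ≡v = trans (sym (pos-^ p r)) (cong +_ (sym v≡pʳ))
        v≢0 : NonZero v
        v≢0 = subst NonZero (sym v≡pʳ) (ℕ.m^n≢0 p r)
      f = proj₁ (stepFactors r e (+ D))
      y′≡ : y + + D * + u ≡ + (exponent ℕ.+ D ℕ.* u)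
      y′≡ = begin
        y + + D * + u              ≡⟨ cong₂ _+_ y≡ (sym (ℤ.pos-* D u)) ⟩
        + exponent + + (D ℕ.* u)   ≡⟨ ℤ.pos-+ exponent (D ℕ.* u) ⟨
        + (exponent ℕ.+ D ℕ.* u)   ∎
        where open ≡-Reasoning
      regroup : ∀ n X z u D → n ℕ.* X ℕ.+ z ℕ.+ n ℕ.* u ℕ.* D ≡ n ℕ.* (X ℕ.+ D ℕ.* u) ℕ.+ z
      regroup = ℕ-Solver.solve-∀
      c′≡aˣ : modZ (c * f) m ≡ a ^ (p-1 ℕ.* (exponent ℕ.+ D ℕ.* u) ℕ.+ z′) mod M
      c′≡aˣ = begin
        modZ (c * f) m                                          ≈⟨ modZ-≡mod _ m ⟩
        c * f                                                   ≈⟨ *-≡mod c≡aˣ (≡mod-trans f≡eᴰ (^-≡mod D e≡aᵘ)) ⟩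
        a ^ (p-1 ℕ.* exponent ℕ.+ z′) * (a ^ (p-1 ℕ.* u)) ^ D   ≡⟨ cong (a ^ (p-1 ℕ.* exponent ℕ.+ z′) *_) (ℤ.^-*-assoc a (p-1 ℕ.* u) D) ⟩
        a ^ (p-1 ℕ.* exponent ℕ.+ z′) * a ^ (p-1 ℕ.* u ℕ.* D)   ≡⟨ ℤ.^-distribˡ-+-* a (p-1 ℕ.* exponent ℕ.+ z′) (p-1 ℕ.* u ℕ.* D) ⟨
        a ^ (p-1 ℕ.* exponent ℕ.+ z′ ℕ.+ p-1 ℕ.* u ℕ.* D)       ≡⟨ cong (a ^_) (regroup p-1 exponent z′ u D) ⟩
        a ^ (p-1 ℕ.* (exponent ℕ.+ D ℕ.* u) ℕ.+ z′)             ∎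
        where open ≡mod-Reasoning M
      [aᵘ]ᵖ≡ : (a ^ (p-1 ℕ.* u)) ^ p ≡ a ^ (p-1 ℕ.* (u ℕ.* p))
      [aᵘ]ᵖ≡ = trans (ℤ.^-*-assoc a (p-1 ℕ.* u) p) (cong (a ^_) (ℕ.*-assoc p-1 u p))
      Pʳ⁺¹∣b-c′ : P ^ suc r ∣ b - modZ (c * f) m
      Pʳ⁺¹∣b-c′ = ≡mod0⇒∣ (begin
        b - modZ (c * f) m                ≈⟨ -‿≡modˡ b (≡modM⇒≡modPʲ r<k (modZ-≡mod _ m)) ⟩
        b - c * f                         ≈⟨ -‿≡modˡ b (*-≡modˡ c f≡1+[e-1]D) ⟩
        b - c * (1ℤ + (e - 1ℤ) * + D)     ≈⟨ ∣⇒≡mod0 (digit-clears r<k (valuation r<k) b-c≡qPʳ D≡gq) ⟩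
        0ℤ                                ∎)
        where open ≡mod-Reasoning (P ^ suc r)

    invariant-step : ∀ s → Invariant s → LoopState.r s ℕ.< k → Invariant (loopBody p k m b g s)
    invariant-step (st y u v r e c) =
      let D , d≡D , D<p = modZ-residue (g * divZ (b - c) v) p
      in  invariant-step′ _ D d≡D D<p (modZ-≡mod _ p)

    b≢c⇒r<k : ∀ {s} → Invariant s → b ≢ LoopState.c s → LoopState.r s ℕ.< k
    b≢c⇒r<k {s} inv b≢c = ℕ.≰⇒> λ k≤r → b≢c (residue-unique b-residue c-residue
      (mod∣ (subst (_∣ b - LoopState.c s) (sym M≡Pᵏ) (∣-trans (^-monoʳ-∣ P k≤r) Pʳ∣b-c))))
      where open Invariant inv

    loop-terminates : ∀ n s → Invariant s → k ℕ.≤ LoopState.r s ℕ.+ n →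
      Σ LoopState λ s′ → loop (suc n) p k m b g s ≡ just s′ × Invariant s′ × b ≡ LoopState.c s′
    loop-terminates n s inv k≤r+n with b ℤ.≟ LoopState.c s
    ... | yes b≡c = s , refl , inv , b≡c
    loop-terminates zero    s inv k≤r+0 | no b≢c =
      contradiction (subst (k ℕ.≤_) (ℕ.+-identityʳ _) k≤r+0) (ℕ.<⇒≱ (b≢c⇒r<k inv b≢c))
    loop-terminates (suc n) s inv k≤r+1+n | no b≢c =
      loop-terminates n (loopBody p k m b g s) (invariant-step s inv (b≢c⇒r<k inv b≢c))
                      (subst (k ℕ.≤_) (ℕ.+-suc _ n) k≤r+1+n)

-- Correctness of DLL

Solvable : ℕ → ℕ → ℤ → ℤ → Set
Solvable p k a b = Σ ℕ λ n → + (p ℕ.^ k) Unsigned.∣ (a ^ n - b)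

Correct : ℕ → ℕ → ℤ → ℤ → Maybe ℤ → Set
Correct p k a b out = (∀ x → out ≡ just x → 0ℤ ≤ x × Σ ℕ λ n → x ≡ + n × + (p ℕ.^ k) Unsigned.∣ (a ^ n - b))
                    × (out ≡ nothing → ¬ Solvable p k a b)

module Problem {p : ℕ} (p-prime : Prime p) (k : ℕ) (a₀ b₀ : ℤ) (z₀ : ℕ)
             (P∤a₀ : ¬ + p ∣ a₀) (a₀ᶻ≡b₀ : a₀ ^ z₀ ≡ b₀ mod + p) where

  open Algorithm p-prime k public

  private instance
    p≢0 = prime⇒nonZero p-prime
    m≢0 = ℕ.m^n≢0 p k

  a = modZ a₀ m
  b = modZ b₀ m

  P∣M : 0 ℕ.< k → P ∣ M
  P∣M k>0 = subst (_∣ M) (ℤ.^-identityʳ P) (Pʲ∣M k>0)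

  ≡modM⇒≡modP : ∀ {x y} → 0 ℕ.< k → x ≡ y mod M → x ≡ y mod P
  ≡modM⇒≡modP = ≡mod-weaken ∘ P∣M

  P∤a : 0 ℕ.< k → ¬ P ∣ a
  P∤a k>0 P∣a = P∤a₀ (≡mod0⇒∣ (≡mod-trans (≡mod-sym (≡modM⇒≡modP k>0 (modZ-≡mod a₀ m))) (∣⇒≡mod0 P∣a)))

  b≡aᶻ : 0 ℕ.< k → b ≡ a ^ z₀ mod P
  b≡aᶻ k>0 = begin
    b         ≈⟨ ≡modM⇒≡modP k>0 (modZ-≡mod b₀ m) ⟩
    b₀        ≈⟨ a₀ᶻ≡b₀ ⟨
    a₀ ^ z₀   ≈⟨ ^-≡mod z₀ (≡modM⇒≡modP k>0 (modZ-≡mod a₀ m)) ⟨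
    a ^ z₀    ∎
    where open ≡mod-Reasoning P

  P∤b : 0 ℕ.< k → ¬ P ∣ b
  P∤b k>0 P∣b = prime∤^ p-prime z₀ (P∤a k>0) (≡mod0⇒∣ (≡mod-trans (≡mod-sym (b≡aᶻ k>0)) (∣⇒≡mod0 P∣b)))

  solution⇒b≡aⁿ : ∀ n → + m Unsigned.∣ (a₀ ^ n - b₀) → b ≡ a ^ n mod M
  solution⇒b≡aⁿ n M∣a₀ⁿ-b₀ = begin
    b         ≈⟨ modZ-≡mod b₀ m ⟩
    b₀        ≈⟨ mod∣ (∣ᵤ⇒∣ M∣a₀ⁿ-b₀) ⟨
    a₀ ^ n    ≈⟨ ^-≡mod n (modZ-≡mod a₀ m) ⟨
    a ^ n     ∎
    where open ≡mod-Reasoning M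

  found-correct : ∀ {x c} N → x ≡ + N → c ≡ a ^ N mod M → b ≡ c → Correct p k a₀ b₀ (just x)
  found-correct N refl c≡aᴺ refl = (λ { _ refl → ℤ.+≤+ ℕ.z≤n , N , refl , ∣⇒∣ᵤ (∣-diff a₀ᴺ≡b₀) }) , λ ()
    where
    a₀ᴺ≡b₀ : a₀ ^ N ≡ b₀ mod M
    a₀ᴺ≡b₀ = begin
      a₀ ^ N   ≈⟨ ^-≡mod N (modZ-≡mod a₀ m) ⟨
      a ^ N    ≈⟨ c≡aᴺ ⟨
      b        ≈⟨ modZ-≡mod b₀ m ⟩
      b₀       ∎
      where open ≡mod-Reasoning M

  none-correct : ¬ Solvable p k a₀ b₀ → Correct p k a₀ b₀ nothing
  none-correct unsolvable = (λ _ ()) , λ _ → unsolvable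

  private instance
    p-1≢0 : NonZero p-1
    p-1≢0 = ℕ.≢-nonZero (ℕ.m>n⇒m∸n≢0 (ℕ.nonTrivial⇒n>1 p {{prime⇒nonTrivial p-prime}}))

  unsolvable-odd : ∀ {r c} → r ℕ.≤ k → a ^ p-1 ≡ 1ℤ mod P ^ r → c ≡ a ^ (z₀ ℕ.% p-1) mod M →
                   ¬ P ^ r ∣ b - c → ¬ Solvable p k a₀ b₀
  unsolvable-odd {zero}  _   _      _     P⁰∤b-c _ = P⁰∤b-c (divides (b - _) (sym (ℤ.*-identityʳ _)))
  unsolvable-odd {suc r} {c} r≤k aᵖ⁻¹≡1 c≡aᶻ′ Pʳ∤b-c (n , M∣a₀ⁿ-b₀) = Pʳ∤b-c (∣-diff (begin
    b                       ≈⟨ ≡modM⇒≡modPʲ r≤k b≡aⁿ ⟩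
    a ^ n                   ≈⟨ ^-≡mod-lift p-prime (suc r) n z₀ (P∤a k>0) aᵖ⁻¹≡1 aⁿ≡aᶻ ⟩
    a ^ z₀                  ≈⟨ ^-≡mod-%ℕ p-1 z₀ aᵖ⁻¹≡1 ⟩
    a ^ (z₀ ℕ.% p-1)        ≈⟨ ≡modM⇒≡modPʲ r≤k c≡aᶻ′ ⟨
    c                       ∎))
    where
    open ≡mod-Reasoning (P ^ suc r)
    k>0 = ℕ.≤-trans (ℕ.s≤s ℕ.z≤n) r≤k
    b≡aⁿ = solution⇒b≡aⁿ n M∣a₀ⁿ-b₀
    aⁿ≡aᶻ : a ^ n ≡ a ^ z₀ mod P
    aⁿ≡aᶻ = ≡mod-trans (≡mod-sym (≡modM⇒≡modP k>0 b≡aⁿ)) (b≡aᶻ k>0)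

  unsolvable-even : ∀ {r c} → r ℕ.≤ k → a ^ 2 ≡ 1ℤ mod P ^ r → c ≡ 1ℤ mod M →
                    ¬ P ^ r ∣ b - c → ¬ P ^ r ∣ b - a → ¬ Solvable p k a₀ b₀
  unsolvable-even {r} {c} r≤k a²≡1 c≡1 Pʳ∤b-c Pʳ∤b-a (n , M∣a₀ⁿ-b₀) =
    by-parity (n ℕ.% 2) (ℕ.m%n<n n 2) (≡mod-trans (≡modM⇒≡modPʲ r≤k (solution⇒b≡aⁿ n M∣a₀ⁿ-b₀)) (^-≡mod-%ℕ 2 n a²≡1))
    where
    by-parity : ∀ i → i ℕ.< 2 → b ≡ a ^ i mod P ^ r → ⊥
    by-parity 0 _ b≡1 = Pʳ∤b-c (∣-diff (≡mod-trans b≡1 (≡mod-sym (≡modM⇒≡modPʲ r≤k c≡1))))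
    by-parity 1 _ b≡a¹ = Pʳ∤b-a (∣-diff (≡mod-trans b≡a¹ (≡⇒≡mod (ℤ.*-identityʳ a))))
    by-parity (suc (suc _)) (ℕ.s≤s (ℕ.s≤s ())) _


  module Run (e : ℤ) (z′ : ℕ) where

    h = proj₁ (strip p k (e - 1ℤ))
    r₀ = proj₂ (strip p k (e - 1ℤ))

    open Loop a b h z′ (modZ-residue b₀ m) P∤b public
    open Stripped (strip-spec p k (e - 1ℤ))

    r₀-minimal : ∀ {i} → P ^ i ∣ e - 1ℤ → r₀ ℕ.< k → i ℕ.≤ r₀
    r₀-minimal = strip-maximal p-prime

    initial-invariant : ∀ {y u c} Y → y ≡ + Y → c ≡ a ^ (p-1 ℕ.* Y ℕ.+ z′) mod M → Residue m c →
      e ≡ a ^ (p-1 ℕ.* u) mod M → P ^ r₀ ∣ b - c → (r₀ ℕ.< k → 1 ℕ.≤ r₀ × (p ≡ 2 → 2 ℕ.≤ r₀)) →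
      Invariant (st y u (p ℕ.^ r₀) r₀ e c)
    initial-invariant Y y≡Y c≡aˣ c-residue e≡aᵘ Pʳ∣b-c r₀-large = record
      { exponent  = Y
      ; y≡        = y≡Y
      ; c≡aˣ      = c≡aˣ
      ; c-residue = c-residue
      ; e≡aᵘ      = e≡aᵘ
      ; v≡pʳ      = refl
      ; r≤k       = r≤j
      ; Pʳ∣b-c    = Pʳ∣b-c
      ; valuation = λ r₀<k → record
        { P∤h     = p∤h r₀<k
        ; r≥1     = proj₁ (r₀-large r₀<k)
        ; r≥2     = proj₂ (r₀-large r₀<k)
        ; e≡1+hPʳ = ≡⇒≡mod (trans (split e) (cong (λ x → 1ℤ + x) x≡hpʳ))
        }
      }
      where split : ∀ e → e ≡ 1ℤ + (e - 1ℤ)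
            split = solve-∀

    run-correct : ∀ {s₀} → Invariant s₀ →
      Σ LoopState λ s → loop (suc k) p k m b g s₀ ≡ just s × Correct p k a₀ b₀ (just (+ p-1 * LoopState.y s + + z′))
    run-correct {s₀} inv₀ =
      let s , loop≡s , inv , b≡c = loop-terminates k s₀ inv₀ (ℕ.m≤n+m k _)
          open Invariant inv
      in  s , loop≡s , found-correct (p-1 ℕ.* exponent ℕ.+ z′) (output≡ y≡) c≡aˣ b≡c
      where
      output≡ : ∀ {y Y} → y ≡ + Y → + p-1 * y + + z′ ≡ + (p-1 ℕ.* Y ℕ.+ z′)
      output≡ {Y = Y} refl = sym (trans (ℤ.pos-+ (p-1 ℕ.* Y) z′) (cong (_+ + z′) (ℤ.pos-* p-1 Y)))

-- Fuel k + 1 suffices: r starts at most k, grows by one per round, and the loop stops at r = k.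
DLL-Result : ℕ → ℕ → ℤ → ℤ → ℕ → Set
DLL-Result p k a b z = Σ (Maybe ℤ) λ out → DLL (suc k) a z b p k ≡ just out × Correct p k a b out

module Odd (q : ℕ) (p-prime : Prime (3 ℕ.+ q)) (k : ℕ) (a₀ b₀ : ℤ) (z₀ : ℕ)
           (P∤a₀ : ¬ + (3 ℕ.+ q) ∣ a₀) (a₀ᶻ≡b₀ : a₀ ^ z₀ ≡ b₀ mod + (3 ℕ.+ q)) where

  open Problem p-prime k a₀ b₀ z₀ P∤a₀ a₀ᶻ≡b₀

  p = 3 ℕ.+ q
  z′ = z₀ ℕ.% (2 ℕ.+ q)
  e₀ = modZ (a ^ (2 ℕ.+ q)) m
  c₀ = modZ (a ^ z′) m

  open Run e₀ z′

  private instance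
    m≢0 = ℕ.m^n≢0 p k
    pʳ≢0 = ℕ.m^n≢0 p r₀

  DLL-found : dividesB (p ℕ.^ r₀) (b - c₀) ≡ true →
              ∀ {s} → loop (suc k) p k m b g (st 0ℤ 1 (p ℕ.^ r₀) r₀ e₀ c₀) ≡ just s →
              DLL (suc k) a₀ z₀ b₀ p k ≡ just (just (+ p-1 * LoopState.y s + + z′))
  DLL-found Pʳ∣b-c loop≡s rewrite Pʳ∣b-c | loop≡s = refl

  DLL-none : dividesB (p ℕ.^ r₀) (b - c₀) ≡ false → DLL (suc k) a₀ z₀ b₀ p k ≡ just nothing
  DLL-none Pʳ∤b-c rewrite Pʳ∤b-c with dividesB (p ℕ.^ r₀) (b - a)
  ... | true  = refl
  ... | false = refl

  result : DLL-Result p k a₀ b₀ z₀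
  result = first-test (dividesB (p ℕ.^ r₀) (b - c₀)) refl (dividesB-reflects (p ℕ.^ r₀) (b - c₀))
    where
    first-test : ∀ t → dividesB (p ℕ.^ r₀) (b - c₀) ≡ t → Reflects (+ (p ℕ.^ r₀) ∣ b - c₀) t →
                 DLL-Result p k a₀ b₀ z₀
    first-test true Pʳ∣?b-c (ofʸ Pʳ∣b-c) =
      let s , loop≡s , correct = run-correct (initial-invariant 0 refl c₀≡aᶻ′ (modZ-residue _ m) e₀≡aᵖ⁻¹
                                                (subst (_∣ b - c₀) (pos-^ p r₀) Pʳ∣b-c) r₀-large)
      in  just _ , DLL-found Pʳ∣?b-c loop≡s , correct
      where
      c₀≡aᶻ′ : c₀ ≡ a ^ (p-1 ℕ.* 0 ℕ.+ z′) mod M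
      c₀≡aᶻ′ = ≡mod-trans (modZ-≡mod _ m) (≡⇒≡mod (cong (λ n → a ^ (n ℕ.+ z′)) (sym (ℕ.*-zeroʳ p-1))))
      e₀≡aᵖ⁻¹ : e₀ ≡ a ^ (p-1 ℕ.* 1) mod M
      e₀≡aᵖ⁻¹ = ≡mod-trans (modZ-≡mod _ m) (≡⇒≡mod (cong (a ^_) (sym (ℕ.*-identityʳ p-1))))
      r₀-large : r₀ ℕ.< k → 1 ℕ.≤ r₀ × (p ≡ 2 → 2 ℕ.≤ r₀)
      r₀-large r₀<k = r₀-minimal P¹∣e₀-1 r₀<k , λ ()
        where
        k>0 = ℕ.≤-<-trans ℕ.z≤n r₀<k
        P¹∣e₀-1 : P ^ 1 ∣ e₀ - 1ℤ
        P¹∣e₀-1 = subst (_∣ e₀ - 1ℤ) (sym (ℤ.^-identityʳ P))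
                    (∣-diff (≡mod-trans (≡modM⇒≡modP k>0 (modZ-≡mod _ m)) (fermat-unit p-prime (P∤a k>0))))
    first-test false Pʳ∤?b-c (ofⁿ Pʳ∤b-c) = nothing , DLL-none Pʳ∤?b-c , none-correct
      (unsolvable-odd r≤j aᵖ⁻¹≡1 (modZ-≡mod _ m) (Pʳ∤b-c ∘ subst (_∣ b - c₀) (sym (pos-^ p r₀))))
      where
      open Stripped (strip-spec p k (e₀ - 1ℤ))
      aᵖ⁻¹≡1 : a ^ p-1 ≡ 1ℤ mod P ^ r₀
      aᵖ⁻¹≡1 = ≡mod-trans (≡mod-sym (≡modM⇒≡modPʲ r≤j (modZ-≡mod _ m))) (mod∣ (divides h x≡hpʳ))

odd-square : ∀ x → ¬ + 2 ∣ x → + 4 ∣ x ^ 2 - 1ℤ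
odd-square x 2∤x = by-remainder (x ℤ.%ℕ 2) (ℤ.n%ℕd<d x 2) (ℤ.a≡a%ℕn+[a/ℕn]*n x 2)
  where
  q = x ℤ./ℕ 2
  expand : ∀ q → (1ℤ + q * + 2) * ((1ℤ + q * + 2) * 1ℤ) - 1ℤ ≡ (q * q + q) * + 4
  expand = solve-∀
  by-remainder : ∀ r → r ℕ.< 2 → x ≡ + r + q * + 2 → + 4 ∣ x ^ 2 - 1ℤ
  by-remainder 0 _ x≡2q = contradiction (divides q (trans x≡2q (ℤ.+-identityˡ _))) 2∤x
  by-remainder 1 _ x≡1+2q = divides (q * q + q) (trans (cong (λ y → y ^ 2 - 1ℤ) x≡1+2q) (expand q))
  by-remainder (suc (suc _)) (ℕ.s≤s (ℕ.s≤s ())) _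

module Even (p-prime : Prime 2) (k : ℕ) (a₀ b₀ : ℤ) (z₀ : ℕ)
            (P∤a₀ : ¬ + 2 ∣ a₀) (a₀ᶻ≡b₀ : a₀ ^ z₀ ≡ b₀ mod + 2) where

  open Problem p-prime k a₀ b₀ z₀ P∤a₀ a₀ᶻ≡b₀

  z′ = z₀ ℕ.% 1
  e₀ = modZ (a ^ 2) m
  c₀ = modZ (a ^ z′) m

  open Run e₀ z′

  private instance
    m≢0 = ℕ.m^n≢0 2 k
    pʳ≢0 = ℕ.m^n≢0 2 r₀

  DLL-found₀ : dividesB (2 ℕ.^ r₀) (b - c₀) ≡ true →
               ∀ {s} → loop (suc k) 2 k m b g (st 0ℤ 2 (2 ℕ.^ r₀) r₀ e₀ c₀) ≡ just s →
               DLL (suc k) a₀ z₀ b₀ 2 k ≡ just (just (+ 1 * LoopState.y s + + z′))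
  DLL-found₀ Pʳ∣b-c loop≡s rewrite Pʳ∣b-c | loop≡s = refl

  DLL-found₁ : dividesB (2 ℕ.^ r₀) (b - c₀) ≡ false → dividesB (2 ℕ.^ r₀) (b - a) ≡ true →
               ∀ {s} → loop (suc k) 2 k m b g (st 1ℤ 2 (2 ℕ.^ r₀) r₀ e₀ a) ≡ just s →
               DLL (suc k) a₀ z₀ b₀ 2 k ≡ just (just (+ 1 * LoopState.y s + + z′))
  DLL-found₁ Pʳ∤b-c Pʳ∣b-a loop≡s rewrite Pʳ∤b-c | Pʳ∣b-a | loop≡s = refl

  DLL-none : dividesB (2 ℕ.^ r₀) (b - c₀) ≡ false → dividesB (2 ℕ.^ r₀) (b - a) ≡ false →
             DLL (suc k) a₀ z₀ b₀ 2 k ≡ just nothing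
  DLL-none Pʳ∤b-c Pʳ∤b-a rewrite Pʳ∤b-c | Pʳ∤b-a = refl

  Pʲ∣e₀-1 : ∀ {j} → 0 ℕ.< k → j ℕ.≤ k → j ℕ.≤ 2 → P ^ j ∣ e₀ - 1ℤ
  Pʲ∣e₀-1 k>0 j≤k j≤2 = ∣-diff (≡mod-trans (≡modM⇒≡modPʲ j≤k (modZ-≡mod _ m))
                          (≡mod-weaken (^-monoʳ-∣ P j≤2) (mod∣ (odd-square a (P∤a k>0)))))

  r₀≥2 : r₀ ℕ.< k → 2 ℕ.≤ r₀
  r₀≥2 r₀<k = r₀-minimal (Pʲ∣e₀-1 k>0 (ℕ.≤-trans (ℕ.s≤s r₀≥1) r₀<k) ℕ.≤-refl) r₀<k
    where
    k>0 = ℕ.≤-<-trans ℕ.z≤n r₀<k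
    r₀≥1 = r₀-minimal (Pʲ∣e₀-1 k>0 k>0 (ℕ.s≤s ℕ.z≤n)) r₀<k

  start : ∀ {y c} Y → y ≡ + Y → c ≡ a ^ (1 ℕ.* Y ℕ.+ z′) mod M → Residue m c → P ^ r₀ ∣ b - c →
          Invariant (st y 2 (2 ℕ.^ r₀) r₀ e₀ c)
  start Y y≡Y c≡aˣ c-residue Pʳ∣b-c =
    initial-invariant Y y≡Y c≡aˣ c-residue (modZ-≡mod _ m) Pʳ∣b-c
      (λ r₀<k → ℕ.≤-trans (ℕ.n≤1+n 1) (r₀≥2 r₀<k) , λ _ → r₀≥2 r₀<k)

  result : DLL-Result 2 k a₀ b₀ z₀
  result = first-test (dividesB (2 ℕ.^ r₀) (b - c₀)) refl (dividesB-reflects (2 ℕ.^ r₀) (b - c₀))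
    where
    Pʳ≡ : + (2 ℕ.^ r₀) ≡ P ^ r₀
    Pʳ≡ = pos-^ 2 r₀
    first-test : ∀ t → dividesB (2 ℕ.^ r₀) (b - c₀) ≡ t → Reflects (+ (2 ℕ.^ r₀) ∣ b - c₀) t →
                 DLL-Result 2 k a₀ b₀ z₀
    first-test true Pʳ∣?b-c (ofʸ Pʳ∣b-c) =
      let s , loop≡s , correct = run-correct (start 0 refl (modZ-≡mod _ m) (modZ-residue _ m) (subst (_∣ b - c₀) Pʳ≡ Pʳ∣b-c))
      in  just _ , DLL-found₀ Pʳ∣?b-c loop≡s , correct
    first-test false Pʳ∣?b-c (ofⁿ Pʳ∤b-c) =
      second-test (dividesB (2 ℕ.^ r₀) (b - a)) refl (dividesB-reflects (2 ℕ.^ r₀) (b - a))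
      where
      second-test : ∀ t → dividesB (2 ℕ.^ r₀) (b - a) ≡ t → Reflects (+ (2 ℕ.^ r₀) ∣ b - a) t →
                    DLL-Result 2 k a₀ b₀ z₀
      second-test true Pʳ∣?b-a (ofʸ Pʳ∣b-a) =
        let s , loop≡s , correct = run-correct (start 1 refl a≡a¹⁺ᶻ′ (modZ-residue a₀ m) (subst (_∣ b - a) Pʳ≡ Pʳ∣b-a))
        in  just _ , DLL-found₁ Pʳ∣?b-c Pʳ∣?b-a loop≡s , correct
        where
        a≡a¹⁺ᶻ′ : a ≡ a ^ (1 ℕ.* 1 ℕ.+ z′) mod M
        a≡a¹⁺ᶻ′ = ≡⇒≡mod (trans (sym (ℤ.*-identityʳ a)) (cong (λ n → a ^ suc n) (sym (ℕ.n%1≡0 z₀))))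
      second-test false Pʳ∣?b-a (ofⁿ Pʳ∤b-a) = nothing , DLL-none Pʳ∣?b-c Pʳ∣?b-a , none-correct
        (unsolvable-even r≤j a²≡1 c₀≡1 (Pʳ∤b-c ∘ subst (_∣ b - c₀) (sym Pʳ≡))
                                       (Pʳ∤b-a ∘ subst (_∣ b - a) (sym Pʳ≡)))
        where
        open Stripped (strip-spec 2 k (e₀ - 1ℤ))
        a²≡1 : a ^ 2 ≡ 1ℤ mod P ^ r₀
        a²≡1 = ≡mod-trans (≡mod-sym (≡modM⇒≡modPʲ r≤j (modZ-≡mod _ m))) (mod∣ (divides h x≡hpʳ))
        c₀≡1 : c₀ ≡ 1ℤ mod M
        c₀≡1 = ≡mod-trans (modZ-≡mod _ m) (≡⇒≡mod (cong (a ^_) (ℕ.n%1≡0 z₀)))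

theorem1 : (p : ℕ) → Prime p → (a b : ℤ) (z k : ℕ) →
    ¬ (+ p Unsigned.∣ a) → + p Unsigned.∣ (a ^ z - b) →
    Σ ℕ (λ fuel → Σ (Maybe ℤ) (λ out →
      DLL fuel a z b p k ≡ just out ×
      ((∀ x → out ≡ just x → ℤ.0ℤ ≤ x × Σ ℕ (λ n → x ≡ + n × + (p ℕ.^ k) Unsigned.∣ (a ^ n - b)))
       × (out ≡ nothing → ¬ (Σ ℕ (λ n → + (p ℕ.^ k) Unsigned.∣ (a ^ n - b)))))))
theorem1 0 p-prime = contradiction p-prime ¬prime[0]
theorem1 1 p-prime = contradiction p-prime ¬prime[1]
theorem1 2 p-prime a b z k p∤a p∣aᶻ-b =
  suc k , Even.result p-prime k a b z (p∤a ∘ ∣⇒∣ᵤ) (mod∣ (∣ᵤ⇒∣ p∣aᶻ-b))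
theorem1 (suc (suc (suc q))) p-prime a b z k p∤a p∣aᶻ-b =
  suc k , Odd.result q p-prime k a b z (p∤a ∘ ∣⇒∣ᵤ) (mod∣ (∣ᵤ⇒∣ p∣aᶻ-b))
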